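{- For every graph $H$ (with $v(H)\ge 2$), $c(H)\ge \tau(H)-1$.
   Context: All graphs are finite and simple. For a graph $G$, $v(G)$ and $e(G)$ denote its numbers of vertices and edges. A graph $H$ is a minor of $G$ if a graph isomorphic to $H$ can be obtained from a subgraph of $G$ by contracting edges. For a graph $H$ with $v(H)\ge 2$, $c(H)$ is the supremum of $e(G)/v(G)$ over all non-null graphs $G$ not containing $H$ as a minor. $\tau(H)$ is the vertex cover number of $H$: the minimum size of a set $X\subseteq V(H)$ such that $H-X$ has no edges. -}

module Defs where

open import Data.Nat using (ℕ; zero; suc; _+_; _≤_; _<ᵇ_)
open import Data.Fin using (Fin; toℕ)
open import Data.Fin.Subset using (Subset; _∈_; ∣_∣)
open import Data.Bool using (Bool; true; false; if_then_else_; _∧_)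
open import Data.Maybe using (Maybe; just)
open import Data.Product using (Σ; _×_; ∃; ∃-syntax)
open import Data.Sum using (_⊎_)
open import Relation.Binary.PropositionalEquality using (_≡_)

record Graph : Set where
  field
    n      : ℕ
    adj    : Fin n → Fin n → Bool
    sym    : ∀ i j → adj i j ≡ adj j i
    irrefl : ∀ i → adj i i ≡ false
open Graph public

sumFin : (n : ℕ) → (Fin n → ℕ) → ℕ
sumFin zero    f = 0
sumFin (suc n) f = f Fin.zero + sumFin n (λ i → f (Fin.suc i))

v : Graph → ℕ
v G = n G

e : Graph → ℕ
e G = sumFin (n G) λ i → sumFin (n G) λ j →
        if (toℕ i <ᵇ toℕ j) ∧ adj G i j then 1 else 0

data ReachIn (G : Graph) (S : Fin (n G) → Set) (u : Fin (n G)) : Fin (n G) → Set where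
  here : S u → ReachIn G S u u
  step : ∀ {w x} → ReachIn G S u w → adj G w x ≡ true → S x → ReachIn G S u x

-- H is a minor of G, via a minor model (branch sets):
-- β assigns every vertex of G to at most one branch set (so the branch sets
-- are pairwise disjoint); every branch set is non-empty and induces a connected
-- subgraph of G; and for every edge xy of H there is an edge of G between the
-- branch sets of x and y.
record MinorModel (H G : Graph) : Set where
  field
    β         : Fin (n G) → Maybe (Fin (n H))
    nonempty  : ∀ (x : Fin (n H)) → ∃[ u ] β u ≡ just x
    connected : ∀ (x : Fin (n H)) (u w : Fin (n G)) →
                β u ≡ just x → β w ≡ just x →
                ReachIn G (λ z → β z ≡ just x) u w
    edges     : ∀ (x y : Fin (n H)) → adj H x y ≡ true →
                ∃[ u ] ∃[ w ] (β u ≡ just x × β w ≡ just y × adj G u w ≡ true)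

IsMinor : Graph → Graph → Set
IsMinor H G = MinorModel H G

IsVertexCover : (H : Graph) → Subset (n H) → Set
IsVertexCover H X = ∀ i j → adj H i j ≡ true → (i ∈ X) ⊎ (j ∈ X)

IsVertexCoverNumber : Graph → ℕ → Set
IsVertexCoverNumber H k =
  (Σ (Subset (n H)) λ X → IsVertexCover H X × ∣ X ∣ ≡ k) ×
  (∀ (X : Subset (n H)) → IsVertexCover H X → k ≤ ∣ X ∣)

-- If Y is a vertex cover of G and β is a minor model of H in G, the branch sets
-- meeting Y cover every edge of H, so τ(H) ≤ |Y|. The complete bipartite graph
-- K_{a,N} has a vertex cover of size a, hence no minor of vertex cover number
-- a + 1, while its density aN/(a + N) exceeds any q < a once N exceeds a times
-- the numerator of q. For τ(H) = 0 a single vertex suffices, as H has at least two vertices.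
module Submission where

open import Defs hiding (sym)
open import Data.Nat using (ℕ; _≤_; NonZero)
open import Data.Integer using (+_)
open import Data.Rational using (ℚ; _/_; _<_; _-_; 1ℚ)
open import Data.Product using (Σ; _×_)
open import Relation.Nullary using (¬_)

open import Data.Nat as ℕ using (zero; suc; _+_; _*_; _<ᵇ_)
import Data.Nat.Properties as ℕP
open import Data.Integer as ℤ using (-[1+_]; 1ℤ)
import Data.Integer.Properties as ℤP
open import Data.Rational using (mkℚ; ↥_; ↧_; -_; toℚᵘ)
import Data.Rational.Properties as ℚP
open import Data.Rational.Properties using (toℚᵘ-mono-<; toℚᵘ-cancel-<; toℚᵘ-fromℚᵘ; toℚᵘ-homo-+; toℚᵘ-homo‿-)
import Data.Rational.Unnormalised as ℚᵘ
import Data.Rational.Unnormalised.Properties as ℚᵘP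
open import Data.Fin as Fin using (Fin; toℕ; _↑ˡ_; _↑ʳ_)
import Data.Fin.Properties as FinP
open import Data.Fin.Subset as Subset using (Subset; inside; outside; ⊤; ⊥; ⁅_⁆; _∪_; ∣_∣)
open import Data.Fin.Subset.Properties using (∣⊥∣≡0; ∣⁅x⁆∣≡1; x∈⁅x⁆; x∈p∪q⁺; ∣p∣≤∣x∷p∣)
open import Data.Vec using ([]; _∷_; _++_; lookup; here; there)
open import Data.Vec.Properties using (lookup-++ˡ; lookup-++ʳ; lookup-replicate; lookup⇒[]=)
open import Data.Bool using (true; false; _∧_; _xor_; if_then_else_)
open import Data.Bool.Properties using (xor-comm; xor-same; ∧-zeroʳ; T-≡; ¬-not)
open import Data.Maybe using (Maybe; just; nothing; maybe)
open import Data.Maybe.Properties using (just-injective)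
open import Data.Product using (_,_; proj₁; proj₂)
open import Data.Sum using (inj₁; inj₂)
open import Function using (_∘_; Injective)
open import Function.Bundles using (Equivalence)
open import Relation.Binary.PropositionalEquality

sumFin-cong : ∀ n {f g : Fin n → ℕ} → (∀ i → f i ≡ g i) → sumFin n f ≡ sumFin n g
sumFin-cong zero    f≗g = refl
sumFin-cong (suc n) f≗g = cong₂ _+_ (f≗g Fin.zero) (sumFin-cong n (f≗g ∘ Fin.suc))

sumFin-const : ∀ n c → sumFin n (λ _ → c) ≡ n * c
sumFin-const zero    c = refl
sumFin-const (suc n) c = cong (_+_ c) (sumFin-const n c)

sumFin-++ : ∀ m n (f : Fin (m + n) → ℕ) →
            sumFin (m + n) f ≡ sumFin m (f ∘ (_↑ˡ n)) + sumFin n (f ∘ (m ↑ʳ_))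
sumFin-++ zero    n f = refl
sumFin-++ (suc m) n f = trans (cong (_+_ (f Fin.zero)) (sumFin-++ m n (f ∘ Fin.suc)))
                              (sym (ℕP.+-assoc (f Fin.zero) _ _))

sumFin-blocks : ∀ m n (f : Fin (m + n) → ℕ) {c d} →
                (∀ i → f (i ↑ˡ n) ≡ c) → (∀ j → f (m ↑ʳ j) ≡ d) →
                sumFin (m + n) f ≡ m * c + n * d
sumFin-blocks m n f {c} {d} left right = begin
  sumFin (m + n) f                                    ≡⟨ sumFin-++ m n f ⟩
  sumFin m (f ∘ (_↑ˡ n)) + sumFin n (f ∘ (m ↑ʳ_))     ≡⟨ cong₂ _+_ (sumFin-cong m left) (sumFin-cong n right) ⟩
  sumFin m (λ _ → c) + sumFin n (λ _ → d)             ≡⟨ cong₂ _+_ (sumFin-const m c) (sumFin-const n d) ⟩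
  m * c + n * d                                       ∎
  where open ≡-Reasoning

∣p∪q∣≤∣p∣+∣q∣ : ∀ {n} (p q : Subset n) → ∣ p ∪ q ∣ ≤ ∣ p ∣ + ∣ q ∣
∣p∪q∣≤∣p∣+∣q∣ []            []            = ℕ.z≤n
∣p∪q∣≤∣p∣+∣q∣ (inside  ∷ p) (s       ∷ q) =
  ℕ.s≤s (ℕP.≤-trans (∣p∪q∣≤∣p∣+∣q∣ p q) (ℕP.+-monoʳ-≤ ∣ p ∣ (∣p∣≤∣x∷p∣ s q)))
∣p∪q∣≤∣p∣+∣q∣ (outside ∷ p) (inside  ∷ q) =
  ℕP.≤-trans (ℕ.s≤s (∣p∪q∣≤∣p∣+∣q∣ p q)) (ℕP.≤-reflexive (sym (ℕP.+-suc ∣ p ∣ ∣ q ∣)))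
∣p∪q∣≤∣p∣+∣q∣ (outside ∷ p) (outside ∷ q) = ∣p∪q∣≤∣p∣+∣q∣ p q

⁅_⁆? : ∀ {n} → Maybe (Fin n) → Subset n
⁅_⁆? = maybe ⁅_⁆ ⊥

∣⁅x⁆?∣≤1 : ∀ {n} (x : Maybe (Fin n)) → ∣ ⁅ x ⁆? ∣ ≤ 1
∣⁅x⁆?∣≤1 (just x)     = ℕP.≤-reflexive (∣⁅x⁆∣≡1 x)
∣⁅x⁆?∣≤1 {n} nothing  = ℕP.≤-trans (ℕP.≤-reflexive (∣⊥∣≡0 n)) ℕ.z≤n

image : ∀ {m n} → (Fin m → Maybe (Fin n)) → Subset m → Subset n
image f []            = ⊥
image f (inside  ∷ p) = ⁅ f Fin.zero ⁆? ∪ image (f ∘ Fin.suc) p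
image f (outside ∷ p) = image (f ∘ Fin.suc) p

∣image∣≤∣p∣ : ∀ {m n} (f : Fin m → Maybe (Fin n)) p → ∣ image f p ∣ ≤ ∣ p ∣
∣image∣≤∣p∣ {n = n} f []  = ℕP.≤-reflexive (∣⊥∣≡0 n)
∣image∣≤∣p∣ f (inside  ∷ p) = ℕP.≤-trans (∣p∪q∣≤∣p∣+∣q∣ ⁅ f Fin.zero ⁆? _)
                                      (ℕP.+-mono-≤ (∣⁅x⁆?∣≤1 (f Fin.zero)) (∣image∣≤∣p∣ (f ∘ Fin.suc) p))
∣image∣≤∣p∣ f (outside ∷ p) = ∣image∣≤∣p∣ (f ∘ Fin.suc) p

∈-image : ∀ {m n} (f : Fin m → Maybe (Fin n)) p {u x} →
          u Subset.∈ p → f u ≡ just x → x Subset.∈ image f p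
∈-image f (inside ∷ p)  {Fin.zero} {x} here    fu≡x rewrite fu≡x = x∈p∪q⁺ (inj₁ (x∈⁅x⁆ x))
∈-image f (inside ∷ p)  {Fin.suc u}    (there u∈p) fu≡x = x∈p∪q⁺ (inj₂ (∈-image (f ∘ Fin.suc) p u∈p fu≡x))
∈-image f (outside ∷ p) {Fin.suc u}    (there u∈p) fu≡x = ∈-image (f ∘ Fin.suc) p u∈p fu≡x

module _ {H G : Graph} (M : MinorModel H G) where
  open MinorModel M

  minor⇒v≤v : v H ≤ v G
  minor⇒v≤v = FinP.injective⇒≤ {f = branchVertex} branchVertex-injective
    where
    branchVertex : Fin (n H) → Fin (n G)
    branchVertex x = proj₁ (nonempty x)
    branchVertex-injective : Injective _≡_ _≡_ branchVertex
    branchVertex-injective {x} {y} eq = just-injective (begin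
      just x                  ≡⟨ sym (proj₂ (nonempty x)) ⟩
      β (branchVertex x)      ≡⟨ cong β eq ⟩
      β (branchVertex y)      ≡⟨ proj₂ (nonempty y) ⟩
      just y                  ∎)
      where open ≡-Reasoning

  image-isVertexCover : ∀ {Y} → IsVertexCover G Y → IsVertexCover H (image β Y)
  image-isVertexCover {Y} cover x y xy with edges x y xy
  ... | u , w , βu≡x , βw≡y , uw with cover u w uw
  ...   | inj₁ u∈Y = inj₁ (∈-image β Y u∈Y βu≡x)
  ...   | inj₂ w∈Y = inj₂ (∈-image β Y w∈Y βw≡y)

<ᵇ-true : ∀ {m n} → m ℕ.< n → (m <ᵇ n) ≡ true
<ᵇ-true m<n = Equivalence.to T-≡ (ℕP.<⇒<ᵇ m<n)

<ᵇ-false : ∀ {m n} → n ≤ m → (m <ᵇ n) ≡ false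
<ᵇ-false {m} {n} n≤m = ¬-not λ m<ᵇn → ℕP.≤⇒≯ n≤m (ℕP.<ᵇ⇒< m n (Equivalence.from T-≡ m<ᵇn))

leftSide : ∀ a b → Subset (a + b)
leftSide a b = ⊤ {a} ++ ⊥ {b}

∣leftSide∣ : ∀ a b → ∣ leftSide a b ∣ ≡ a
∣leftSide∣ zero    b = ∣⊥∣≡0 b
∣leftSide∣ (suc a) b = cong suc (∣leftSide∣ a b)

leftSide-↑ˡ : ∀ {a} b (i : Fin a) → lookup (leftSide a b) (i ↑ˡ b) ≡ true
leftSide-↑ˡ b i = trans (lookup-++ˡ ⊤ (⊥ {b}) i) (lookup-replicate i inside)

leftSide-↑ʳ : ∀ a {b} (j : Fin b) → lookup (leftSide a b) (a ↑ʳ j) ≡ false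
leftSide-↑ʳ a j = trans (lookup-++ʳ (⊤ {a}) ⊥ j) (lookup-replicate j outside)

completeBipartite : ℕ → ℕ → Graph
completeBipartite a b = record
  { n      = a + b
  ; adj    = λ i j → lookup L i xor lookup L j
  ; sym    = λ i j → xor-comm (lookup L i) (lookup L j)
  ; irrefl = λ i → xor-same (lookup L i)
  }
  where L = leftSide a b

e-completeBipartite : ∀ a b → e (completeBipartite a b) ≡ a * b
e-completeBipartite a b = begin
  e (completeBipartite a b)   ≡⟨ sumFin-blocks a b _ leftRow rightRow ⟩
  a * b + b * 0               ≡⟨ cong (_+_ (a * b)) (ℕP.*-zeroʳ b) ⟩
  a * b + 0                   ≡⟨ ℕP.+-identityʳ (a * b) ⟩
  a * b                       ∎
  where
  open ≡-Reasoning
  L = leftSide a b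
  entry : Fin (a + b) → Fin (a + b) → ℕ
  entry i j = if (toℕ i <ᵇ toℕ j) ∧ (lookup L i xor lookup L j) then 1 else 0

  row : Fin (a + b) → ℕ
  row i = sumFin (a + b) (entry i)

  leftRow : ∀ i → row (i ↑ˡ b) ≡ b
  leftRow i = trans (sumFin-blocks a b _ same cross) (cong₂ _+_ (ℕP.*-zeroʳ a) (ℕP.*-identityʳ b))
    where
    same : ∀ j → entry (i ↑ˡ b) (j ↑ˡ b) ≡ 0
    same j rewrite leftSide-↑ˡ b i | leftSide-↑ˡ b j | ∧-zeroʳ (toℕ (i ↑ˡ b) <ᵇ toℕ (j ↑ˡ b)) = refl
    i<j : ∀ j → toℕ (i ↑ˡ b) ℕ.< toℕ (a ↑ʳ j)
    i<j j = subst₂ ℕ._<_ (sym (FinP.toℕ-↑ˡ i b)) (sym (FinP.toℕ-↑ʳ a j))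
                   (ℕP.<-≤-trans (FinP.toℕ<n i) (ℕP.m≤m+n a (toℕ j)))
    cross : ∀ j → entry (i ↑ˡ b) (a ↑ʳ j) ≡ 1
    cross j rewrite leftSide-↑ˡ b i | leftSide-↑ʳ a j | <ᵇ-true (i<j j) = refl

  rightRow : ∀ i → row (a ↑ʳ i) ≡ 0
  rightRow i = trans (sumFin-blocks a b _ cross same) (cong₂ _+_ (ℕP.*-zeroʳ a) (ℕP.*-zeroʳ b))
    where
    j≤i : ∀ j → toℕ (j ↑ˡ b) ≤ toℕ (a ↑ʳ i)
    j≤i j = subst₂ _≤_ (sym (FinP.toℕ-↑ˡ j b)) (sym (FinP.toℕ-↑ʳ a i))
                   (ℕP.≤-trans (ℕP.<⇒≤ (FinP.toℕ<n j)) (ℕP.m≤m+n a (toℕ i)))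
    cross : ∀ j → entry (a ↑ʳ i) (j ↑ˡ b) ≡ 0
    cross j rewrite <ᵇ-false (j≤i j) = refl
    same : ∀ j → entry (a ↑ʳ i) (a ↑ʳ j) ≡ 0
    same j rewrite leftSide-↑ʳ a i | leftSide-↑ʳ a j | ∧-zeroʳ (toℕ (a ↑ʳ i) <ᵇ toℕ (a ↑ʳ j)) = refl

leftSide-isVertexCover : ∀ a b → IsVertexCover (completeBipartite a b) (leftSide a b)
leftSide-isVertexCover a b i j edge with lookup (leftSide a b) i in left
... | true  = inj₁ (lookup⇒[]= i _ left)
... | false = inj₂ (lookup⇒[]= j _ edge)

completeBipartite-minor-free : ∀ {H} a b → IsVertexCoverNumber H (suc a) →
                               ¬ IsMinor H (completeBipartite a b)
completeBipartite-minor-free a b (_ , minimal) M = ℕP.n≮n a (begin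
  suc a                               ≤⟨ minimal _ (image-isVertexCover M (leftSide-isVertexCover a b)) ⟩
  ∣ image β (leftSide a b) ∣          ≤⟨ ∣image∣≤∣p∣ β (leftSide a b) ⟩
  ∣ leftSide a b ∣                    ≡⟨ ∣leftSide∣ a b ⟩
  a                                   ∎)
  where
  open MinorModel M
  open ℕP.≤-Reasoning

↥*d<i*↧⇒<i/d : ∀ (q : ℚ) i d .{{_ : NonZero d}} → ↥ q ℤ.* + d ℤ.< i ℤ.* ↧ q → q < i / d
↥*d<i*↧⇒<i/d q@(mkℚ _ _ _) i (suc d) cross =
  toℚᵘ-cancel-< (ℚᵘP.<-respʳ-≃ (ℚᵘP.≃-sym (toℚᵘ-fromℚᵘ (ℚᵘ.mkℚᵘ i d))) (ℚᵘ.*<* cross))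

toℚᵘ-k/1-1 : ∀ k → toℚᵘ (+ k / 1 - 1ℚ) ℚᵘ.≃ ℚᵘ.mkℚᵘ (+ k) 0 ℚᵘ.- ℚᵘ.1ℚᵘ
toℚᵘ-k/1-1 k = ℚᵘP.≃-trans (toℚᵘ-homo-+ (+ k / 1) (- 1ℚ))
  (ℚᵘP.+-cong (toℚᵘ-fromℚᵘ (ℚᵘ.mkℚᵘ (+ k) 0)) (toℚᵘ-homo‿- 1ℚ))

<k-1⇒↥<[k-1]*↧ : ∀ (q : ℚ) k → q < + k / 1 - 1ℚ → ↥ q ℤ.< (+ k ℤ.- 1ℤ) ℤ.* ↧ q
<k-1⇒↥<[k-1]*↧ q@(mkℚ _ _ _) k q<k-1 with ℚᵘP.<-respʳ-≃ (toℚᵘ-k/1-1 k) (toℚᵘ-mono-< q<k-1)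
... | ℚᵘ.*<* cross = subst₂ ℤ._<_ (ℤP.*-identityʳ (↥ q)) (cong ((ℤ._* ↧ q) ∘ (ℤ._- 1ℤ)) (ℤP.*-identityʳ (+ k))) cross

-- m/D < a implies m/D < aN/(a + N) once N > m a, since (a + N) m < N (m + 1) ≤ N a D.
m<a*D⇒m*[a+N]<a*N*D : ∀ m a D → m ℕ.< a * D → m * (a + suc (m * a)) ℕ.< a * suc (m * a) * D
m<a*D⇒m*[a+N]<a*N*D m a D m<aD = begin-strict
  m * (a + N)          ≡⟨ ℕP.*-distribˡ-+ m a N ⟩
  m * a + m * N        <⟨ ℕP.+-monoʳ-< (m * a) (ℕP.n<1+n (m * N)) ⟩
  m * a + suc (m * N)  ≡⟨ ℕP.+-suc (m * a) (m * N) ⟩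
  suc m * N            ≤⟨ ℕP.*-monoˡ-≤ N m<aD ⟩
  a * D * N            ≡⟨ ℕP.*-comm (a * D) N ⟩
  N * (a * D)          ≡⟨ sym (ℕP.*-assoc N a D) ⟩
  N * a * D            ≡⟨ cong (_* D) (ℕP.*-comm N a) ⟩
  a * N * D            ∎
  where
  open ℕP.≤-Reasoning
  N = suc (m * a)

rightSize : ℚ → ℕ → ℕ
rightSize q a = suc (ℤ.∣ ↥ q ∣ * a)

↥<a↧⇒↥*[a+N]<a*N*↧ : ∀ (q : ℚ) a → ↥ q ℤ.< + a ℤ.* ↧ q →
                     ↥ q ℤ.* + (a + rightSize q a) ℤ.< + (a * rightSize q a) ℤ.* ↧ q
↥<a↧⇒↥*[a+N]<a*N*↧ (mkℚ (+ m) d _) a q<a =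
  subst₂ ℤ._<_ (ℤP.pos-* m _) (ℤP.pos-* (a * suc (m * a)) (suc d))
    (ℤ.+<+ (m<a*D⇒m*[a+N]<a*N*D m a (suc d) (ℤP.drop‿+<+ (subst (+ m ℤ.<_) (sym (ℤP.pos-* a (suc d))) q<a))))
-- For a negative numerator, exposing a + N as a successor makes the left side compute to a negative integer.
↥<a↧⇒↥*[a+N]<a*N*↧ (mkℚ -[1+ m ] d _) a _
  rewrite ℕP.+-suc a (suc m * a) | sym (ℤP.pos-* (a * suc (suc m * a)) (suc d)) = ℤ.-<+

rightSize-nonZero : ∀ q a → NonZero (a + rightSize q a)
rightSize-nonZero q a = ℕ.>-nonZero (ℕP.<-≤-trans ℕ.z<s (ℕP.m≤n+m (rightSize q a) a))

<completeBipartiteDensity : ∀ q a → q < + suc a / 1 - 1ℚ →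
  q < _/_ (+ (a * rightSize q a)) (a + rightSize q a) {{rightSize-nonZero q a}}
-- + suc a ℤ.- 1ℤ reduces to + a.
<completeBipartiteDensity q a q<a =
  ↥*d<i*↧⇒<i/d q (+ (a * rightSize q a)) (a + rightSize q a) {{rightSize-nonZero q a}}
    (↥<a↧⇒↥*[a+N]<a*N*↧ q a (<k-1⇒↥<[k-1]*↧ q (suc a) q<a))

lemma2p3 : (H : Graph) → 2 ≤ v H → (k : ℕ) → IsVertexCoverNumber H k →
    (q : ℚ) → q < (+ k / 1) - 1ℚ →
    Σ Graph λ G → Σ (NonZero (v G)) λ nz →
      ¬ IsMinor H G × q < (_/_ (+ e G) (v G) {{nz}})
lemma2p3 H 2≤vH zero _ q q<-1 =
  completeBipartite 0 1 , _ , (λ M → ℕP.<⇒≱ 2≤vH (minor⇒v≤v M)) , ℚP.<-trans q<-1 (ℚP.negative⁻¹ _)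
lemma2p3 H _ (suc a) τH q q<a =
  completeBipartite a N , nz , completeBipartite-minor-free a N τH ,
  subst (λ m → q < _/_ (+ m) (a + N) {{nz}}) (sym (e-completeBipartite a N))
        (<completeBipartiteDensity q a q<a)
  where
  N  = rightSize q a
  nz = rightSize-nonZero q a
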